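{- Every $5$-uniform intersecting hypergraph with exactly $12$ edges and at least $21$ vertices, each vertex lying in at least one edge, has covering number at most $4$.
   Context: A hypergraph is $r$-uniform if every edge has exactly $r$ vertices, and intersecting if any two edges share at least one vertex. The covering number is the minimum size of a set of vertices meeting every edge. Hypergraphs are finite and simple. -}

module Defs where

open import Data.Nat using (ℕ; _≤_)
open import Data.Fin using (Fin)
open import Data.Fin.Subset using (Subset; _∈_; ∣_∣)
open import Data.Product using (Σ; ∃; _×_; _,_)
open import Relation.Binary.PropositionalEquality using (_≡_)

record Hypergraph (n m : ℕ) : Set where
  field
    edge     : Fin m → Subset n
    distinct : ∀ i j → edge i ≡ edge j → i ≡ j

open Hypergraph public

Uniform : ∀ {n m} → ℕ → Hypergraph n m → Set
Uniform r H = ∀ i → ∣ edge H i ∣ ≡ r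

Intersecting : ∀ {n m} → Hypergraph n m → Set
Intersecting {n} H = ∀ i j → ∃ λ (v : Fin n) → v ∈ edge H i × v ∈ edge H j

NoIsolated : ∀ {n m} → Hypergraph n m → Set
NoIsolated {n} {m} H = ∀ (v : Fin n) → ∃ λ (i : Fin m) → v ∈ edge H i

IsCover : ∀ {n m} → Hypergraph n m → Subset n → Set
IsCover {n} H C = ∀ i → ∃ λ (v : Fin n) → v ∈ C × v ∈ edge H i

CoverNumberAtMost : ∀ {n m} → Hypergraph n m → ℕ → Set
CoverNumberAtMost {n} H k = ∃ λ (C : Subset n) → IsCover H C × ∣ C ∣ ≤ k

-- Suppose no four vertices cover the edges. Deleting a vertex of degree 1 from its edge leaves
-- a 4-set that still meets every edge, so all degrees are at least 2. If an edge E contained two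
-- vertices x, y of degree 2, lying also in the edges F and G, then E - x - y together with a common
-- vertex of F and G would be a cover of size 4; so each edge has at most one vertex of degree 2.
-- Double counting now gives Σ d = 60, Σ d² = Σ_{E,F} |E ∩ F| ≥ 12 (5 + 11) = 192 and
-- Σ_{d(v) = 2} d(v) ≤ 12, and with at least 21 vertices these three facts are incompatible.

module Submission where

open import Data.Bool.Base using (if_then_else_)
open import Data.Empty using (⊥-elim)
open import Data.Fin.Base using (Fin; zero; suc; punchIn; punchOut)
open import Data.Fin.Properties using (_≟_; any?; all?; punchInᵢ≢i; punchIn-punchOut; punchOut-injective)
open import Data.Fin.Subset using (Subset; _∈_; ∣_∣; _-_; _∪_; ⁅_⁆; Nonempty; inside; outside)
open import Data.Fin.Subset.Properties
  using (_∈?_; anySubset?; p─⊥≡p; x∈p∧x≢y⇒x∈p-y; p─q⊆p; x∈p∪q⁺; x∈⁅x⁆; ∣⁅x⁆∣≡1)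
open import Data.Nat.Base using (ℕ; zero; suc; pred; _+_; _*_; _≤_; _<_; z≤n; s≤s)
open import Data.Nat.Properties hiding (_≟_)
open import Data.Product using (∃; _×_; _,_)
open import Data.Sum using (_⊎_; inj₁; inj₂)
open import Data.Vec.Base using (_∷_; []; lookup; here; there)
open import Data.Vec.Functional using (Vector; removeAt)
open import Function.Base using (_∘_)
open import Relation.Binary.PropositionalEquality
open import Relation.Nullary using (¬_; Dec; yes; no)
open import Relation.Nullary.Decidable using (_×-dec_)

open import Algebra.Properties.Semiring.Sum +-*-semiring
  using (sum; sum-syntax; sum-cong-≗; sum-remove; ∑-comm; ∑-distrib-+; *-distribˡ-sum; *-distribʳ-sum)

open import Defs

∑-const : ∀ n c → ∑[ i < n ] c ≡ n * c
∑-const zero    c = refl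
∑-const (suc n) c = cong (c +_) (∑-const n c)

∑-mono-≤ : ∀ {n} {f g : Vector ℕ n} → (∀ i → f i ≤ g i) → sum f ≤ sum g
∑-mono-≤ {zero}  f≤g = z≤n
∑-mono-≤ {suc n} f≤g = +-mono-≤ (f≤g zero) (∑-mono-≤ (f≤g ∘ suc))

0<∑⇒∃0< : ∀ {n} (f : Vector ℕ n) → 0 < sum f → ∃ λ i → 0 < f i
0<∑⇒∃0< {suc n} f 0<∑ with f zero in f₀≡
... | suc _ = zero , subst (0 <_) (sym f₀≡) (s≤s z≤n)
... | zero  with 0<∑⇒∃0< (f ∘ suc) 0<∑
...   | i , 0<fᵢ = suc i , 0<fᵢ

fᵢ≤∑f : ∀ {n} (f : Vector ℕ n) i → f i ≤ sum f
fᵢ≤∑f {suc n} f i = begin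
  f i                       ≤⟨ m≤m+n (f i) _ ⟩
  f i + sum (removeAt f i)  ≡⟨ sum-remove f ⟨
  sum f                     ∎
  where open ≤-Reasoning

fᵢ+fⱼ≤∑f : ∀ {n} (f : Vector ℕ n) {i j} → i ≢ j → f i + f j ≤ sum f
fᵢ+fⱼ≤∑f {suc n} f {i} {j} i≢j = begin
  f i + f j                          ≡⟨ cong (λ k → f i + f k) (punchIn-punchOut i≢j) ⟨
  f i + removeAt f i (punchOut i≢j)  ≤⟨ +-monoʳ-≤ (f i) (fᵢ≤∑f (removeAt f i) (punchOut i≢j)) ⟩
  f i + sum (removeAt f i)           ≡⟨ sum-remove f ⟨
  sum f                              ∎
  where open ≤-Reasoning

fᵢ+fⱼ+fₖ≤∑f : ∀ {n} (f : Vector ℕ n) {i j k} → i ≢ j → i ≢ k → j ≢ k → f i + f j + f k ≤ sum f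
fᵢ+fⱼ+fₖ≤∑f {suc n} f {i} {j} {k} i≢j i≢k j≢k = begin
  f i + f j + f k
    ≡⟨ +-assoc (f i) (f j) (f k) ⟩
  f i + (f j + f k)
    ≡⟨ cong₂ (λ a b → f i + (f a + f b)) (punchIn-punchOut i≢j) (punchIn-punchOut i≢k) ⟨
  f i + (removeAt f i (punchOut i≢j) + removeAt f i (punchOut i≢k))
    ≤⟨ +-monoʳ-≤ (f i) (fᵢ+fⱼ≤∑f (removeAt f i) (j≢k ∘ punchOut-injective i≢j i≢k)) ⟩
  f i + sum (removeAt f i)
    ≡⟨ sum-remove f ⟨
  sum f
    ∎
  where open ≤-Reasoning

fᵢ+[m-1]a≤∑f : ∀ {m} (f : Vector ℕ m) i {a} → (∀ j → j ≢ i → a ≤ f j) → f i + pred m * a ≤ sum f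
fᵢ+[m-1]a≤∑f {suc m} f i {a} a≤fⱼ = begin
  f i + m * a               ≡⟨ cong (f i +_) (∑-const m a) ⟨
  f i + ∑[ j < m ] a        ≤⟨ +-monoʳ-≤ (f i) (∑-mono-≤ (λ j → a≤fⱼ (punchIn i j) (punchInᵢ≢i i j))) ⟩
  f i + sum (removeAt f i)  ≡⟨ sum-remove f ⟨
  sum f                     ∎
  where open ≤-Reasoning

2≤∑⇒∃0<≢ : ∀ {n} (f : Vector ℕ n) i → f i ≤ 1 → 2 ≤ sum f → ∃ λ j → j ≢ i × 0 < f j
2≤∑⇒∃0<≢ {suc n} f i fᵢ≤1 2≤∑ with 0<∑⇒∃0< (removeAt f i) 0<∑rest
  where
  0<∑rest : 0 < sum (removeAt f i)
  0<∑rest = +-cancelˡ-≤ 1 _ _ (≤-trans 2≤∑ (≤-trans (≤-reflexive (sum-remove f)) (+-monoˡ-≤ _ fᵢ≤1)))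
... | j , 0<fⱼ = punchIn i j , punchInᵢ≢i i j , 0<fⱼ

incidence : ∀ {n} → Subset n → Fin n → ℕ
incidence p v = if lookup p v then 1 else 0

incidence≤1 : ∀ {n} (p : Subset n) v → incidence p v ≤ 1
incidence≤1 p v with lookup p v
... | inside  = ≤-refl
... | outside = z≤n

incidence-idem : ∀ {n} (p : Subset n) v → incidence p v * incidence p v ≡ incidence p v
incidence-idem p v with lookup p v
... | inside  = refl
... | outside = refl

∈⇒incidence≡1 : ∀ {n} {p : Subset n} {v} → v ∈ p → incidence p v ≡ 1
∈⇒incidence≡1 here        = refl
∈⇒incidence≡1 (there v∈p) = ∈⇒incidence≡1 v∈p

0<incidence⇒∈ : ∀ {n} (p : Subset n) v → 0 < incidence p v → v ∈ p
0<incidence⇒∈ (inside ∷ p) zero    _   = here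
0<incidence⇒∈ (_      ∷ p) (suc v) 0<i = there (0<incidence⇒∈ p v 0<i)

∣p∣≡∑incidence : ∀ {n} (p : Subset n) → ∣ p ∣ ≡ sum (incidence p)
∣p∣≡∑incidence []            = refl
∣p∣≡∑incidence (inside  ∷ p) = cong suc (∣p∣≡∑incidence p)
∣p∣≡∑incidence (outside ∷ p) = ∣p∣≡∑incidence p

0<∣p∣⇒Nonempty : ∀ {n} (p : Subset n) → 0 < ∣ p ∣ → Nonempty p
0<∣p∣⇒Nonempty p 0<∣p∣ with 0<∑⇒∃0< (incidence p) (subst (0 <_) (∣p∣≡∑incidence p) 0<∣p∣)
... | v , 0<i = v , 0<incidence⇒∈ p v 0<i

x∈p⇒suc∣p-x∣≡∣p∣ : ∀ {n} {p : Subset n} {x} → x ∈ p → suc ∣ p - x ∣ ≡ ∣ p ∣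
x∈p⇒suc∣p-x∣≡∣p∣ {p = inside  ∷ p} here        = cong suc (cong ∣_∣ (p─⊥≡p p))
x∈p⇒suc∣p-x∣≡∣p∣ {p = inside  ∷ p} (there x∈p) = cong suc (x∈p⇒suc∣p-x∣≡∣p∣ x∈p)
x∈p⇒suc∣p-x∣≡∣p∣ {p = outside ∷ p} (there x∈p) = x∈p⇒suc∣p-x∣≡∣p∣ x∈p

∣p∪q∣≤∣p∣+∣q∣ : ∀ {n} (p q : Subset n) → ∣ p ∪ q ∣ ≤ ∣ p ∣ + ∣ q ∣
∣p∪q∣≤∣p∣+∣q∣ []            []            = z≤n
∣p∪q∣≤∣p∣+∣q∣ (inside  ∷ p) (inside  ∷ q) =
  s≤s (≤-trans (∣p∪q∣≤∣p∣+∣q∣ p q) (+-monoʳ-≤ ∣ p ∣ (n≤1+n ∣ q ∣)))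
∣p∪q∣≤∣p∣+∣q∣ (inside  ∷ p) (outside ∷ q) = s≤s (∣p∪q∣≤∣p∣+∣q∣ p q)
∣p∪q∣≤∣p∣+∣q∣ (outside ∷ p) (inside  ∷ q) =
  ≤-trans (s≤s (∣p∪q∣≤∣p∣+∣q∣ p q)) (≤-reflexive (sym (+-suc ∣ p ∣ ∣ q ∣)))
∣p∪q∣≤∣p∣+∣q∣ (outside ∷ p) (outside ∷ q) = ∣p∪q∣≤∣p∣+∣q∣ p q

isTwo : ℕ → ℕ
isTwo 2 = 1
isTwo _ = 0

isTwo≤1 : ∀ d → isTwo d ≤ 1
isTwo≤1 0                   = z≤n
isTwo≤1 1                   = z≤n
isTwo≤1 2                   = ≤-refl
isTwo≤1 (suc (suc (suc _))) = z≤n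

0<isTwo⇒≡2 : ∀ d → 0 < isTwo d → d ≡ 2
0<isTwo⇒≡2 2 _ = refl

0<m*n⇒0<m∧0<n : ∀ m n → 0 < m * n → 0 < m × 0 < n
0<m*n⇒0<m∧0<n (suc m) (suc n) _     = s≤s z≤n , s≤s z≤n
0<m*n⇒0<m∧0<n (suc m) zero    0<m*0 = ⊥-elim (<-irrefl refl (subst (0 <_) (*-zeroʳ m) 0<m*0))

degree : ∀ {n m} → Hypergraph n m → Fin n → ℕ
degree {m = m} H v = ∑[ i < m ] incidence (edge H i) v

module _ {n m} (H : Hypergraph n m) where

  2≤degree : ∀ {v i j} → i ≢ j → v ∈ edge H i → v ∈ edge H j → 2 ≤ degree H v
  2≤degree {v} i≢j v∈i v∈j =
    subst₂ (λ a b → a + b ≤ degree H v) (∈⇒incidence≡1 v∈i) (∈⇒incidence≡1 v∈j) (fᵢ+fⱼ≤∑f _ i≢j)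

  3≤degree : ∀ {v i j k} → i ≢ j → i ≢ k → j ≢ k →
             v ∈ edge H i → v ∈ edge H j → v ∈ edge H k → 3 ≤ degree H v
  3≤degree {v} i≢j i≢k j≢k v∈i v∈j v∈k =
    subst₂ (λ a b → a + b ≤ degree H v)
      (cong₂ _+_ (∈⇒incidence≡1 v∈i) (∈⇒incidence≡1 v∈j)) (∈⇒incidence≡1 v∈k)
      (fᵢ+fⱼ+fₖ≤∑f _ i≢j i≢k j≢k)

  degree≤1⇒k≡i : ∀ {v i k} → degree H v ≤ 1 → v ∈ edge H i → v ∈ edge H k → k ≡ i
  degree≤1⇒k≡i {i = i} {k} deg≤1 v∈i v∈k with k ≟ i
  ... | yes k≡i = k≡i
  ... | no  k≢i = ⊥-elim (<⇒≱ (s≤s deg≤1) (2≤degree k≢i v∈k v∈i))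

  degree≤2⇒k≡i∨k≡j : ∀ {v i j k} → degree H v ≤ 2 → j ≢ i →
                     v ∈ edge H i → v ∈ edge H j → v ∈ edge H k → k ≡ i ⊎ k ≡ j
  degree≤2⇒k≡i∨k≡j {i = i} {j} {k} deg≤2 j≢i v∈i v∈j v∈k with k ≟ i | k ≟ j
  ... | yes k≡i | _       = inj₁ k≡i
  ... | no  _   | yes k≡j = inj₂ k≡j
  ... | no  k≢i | no  k≢j =
    ⊥-elim (<⇒≱ (s≤s deg≤2) (3≤degree (j≢i ∘ sym) (k≢i ∘ sym) (k≢j ∘ sym) v∈i v∈j v∈k))

  2≤degree⇒∈-other-edge : ∀ {v} → 2 ≤ degree H v → ∀ i → ∃ λ j → j ≢ i × v ∈ edge H j
  2≤degree⇒∈-other-edge {v} 2≤deg i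
    with 2≤∑⇒∃0<≢ (λ j → incidence (edge H j) v) i (incidence≤1 (edge H i) v) 2≤deg
  ... | j , j≢i , 0<i = j , j≢i , 0<incidence⇒∈ (edge H j) v 0<i

  ∑-degree-* : ∀ (g : Fin n → ℕ) →
               ∑[ v < n ] (degree H v * g v) ≡ ∑[ i < m ] ∑[ v < n ] (incidence (edge H i) v * g v)
  ∑-degree-* g = trans (sum-cong-≗ (λ v → *-distribʳ-sum (g v) (λ i → incidence (edge H i) v)))
                       (∑-comm (λ v i → incidence (edge H i) v * g v))

  handshake : ∀ {r} → Uniform r H → sum (degree H) ≡ m * r
  handshake {r} uniform = begin
    ∑[ v < n ] ∑[ i < m ] incidence (edge H i) v
      ≡⟨ ∑-comm (λ v i → incidence (edge H i) v) ⟩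
    ∑[ i < m ] sum (incidence (edge H i))
      ≡⟨ sum-cong-≗ (λ i → trans (sym (∣p∣≡∑incidence (edge H i))) (uniform i)) ⟩
    ∑[ i < m ] r
      ≡⟨ ∑-const m r ⟩
    m * r
      ∎
    where open ≡-Reasoning

  overlapSize : Fin m → Fin m → ℕ
  overlapSize i j = ∑[ v < n ] (incidence (edge H i) v * incidence (edge H j) v)

  ∑-degree² : ∑[ v < n ] (degree H v * degree H v) ≡ ∑[ i < m ] ∑[ j < m ] overlapSize i j
  ∑-degree² = trans (∑-degree-* (degree H)) (sum-cong-≗ row)
    where
    row : ∀ i → ∑[ v < n ] (incidence (edge H i) v * degree H v) ≡ ∑[ j < m ] overlapSize i j
    row i = trans (sum-cong-≗ (λ v → *-distribˡ-sum (incidence (edge H i) v) (λ j → incidence (edge H j) v)))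
                  (∑-comm (λ v j → incidence (edge H i) v * incidence (edge H j) v))

  overlapSize-self : ∀ {r} → Uniform r H → ∀ i → overlapSize i i ≡ r
  overlapSize-self {r} uniform i = begin
    overlapSize i i             ≡⟨ sum-cong-≗ (incidence-idem (edge H i)) ⟩
    sum (incidence (edge H i))  ≡⟨ ∣p∣≡∑incidence (edge H i) ⟨
    ∣ edge H i ∣                ≡⟨ uniform i ⟩
    r                           ∎
    where open ≡-Reasoning

  1≤overlapSize : Intersecting H → ∀ i j → 1 ≤ overlapSize i j
  1≤overlapSize intersecting i j with intersecting i j
  ... | w , w∈i , w∈j =
    subst (_≤ overlapSize i j) (cong₂ _*_ (∈⇒incidence≡1 w∈i) (∈⇒incidence≡1 w∈j)) (fᵢ≤∑f _ w)

  r+[m-1]≤∑overlapSize : ∀ {r} → Uniform r H → Intersecting H → ∀ i →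
                         r + pred m ≤ ∑[ j < m ] overlapSize i j
  r+[m-1]≤∑overlapSize {r} uniform intersecting i = begin
    r + pred m                    ≡⟨ cong₂ _+_ (overlapSize-self uniform i) (*-identityʳ (pred m)) ⟨
    overlapSize i i + pred m * 1  ≤⟨ fᵢ+[m-1]a≤∑f (overlapSize i) i (λ j _ → 1≤overlapSize intersecting i j) ⟩
    ∑[ j < m ] overlapSize i j    ∎
    where open ≤-Reasoning

  m[r+m-1]≤∑degree² : ∀ {r} → Uniform r H → Intersecting H →
                      m * (r + pred m) ≤ ∑[ v < n ] (degree H v * degree H v)
  m[r+m-1]≤∑degree² {r} uniform intersecting = begin
    m * (r + pred m)                       ≡⟨ ∑-const m (r + pred m) ⟨
    ∑[ i < m ] (r + pred m)                ≤⟨ ∑-mono-≤ (r+[m-1]≤∑overlapSize uniform intersecting) ⟩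
    ∑[ i < m ] ∑[ j < m ] overlapSize i j  ≡⟨ ∑-degree² ⟨
    ∑[ v < n ] (degree H v * degree H v)   ∎
    where open ≤-Reasoning

  degree≤1⇒CoverNumberAtMost : ∀ {r v i} → Uniform (2 + r) H → Intersecting H →
                               v ∈ edge H i → degree H v ≤ 1 → CoverNumberAtMost H (1 + r)
  degree≤1⇒CoverNumberAtMost {r} {v} {i} uniform intersecting v∈i deg≤1 =
    edge H i - v , covers , ≤-reflexive size
    where
    size : ∣ edge H i - v ∣ ≡ 1 + r
    size = suc-injective (trans (x∈p⇒suc∣p-x∣≡∣p∣ v∈i) (uniform i))

    covers : IsCover H (edge H i - v)
    covers k with intersecting i k
    ... | w , w∈i , w∈k with w ≟ v
    ...   | no  w≢v = w , x∈p∧x≢y⇒x∈p-y w∈i w≢v , w∈k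
    ...   | yes refl with degree≤1⇒k≡i deg≤1 w∈i w∈k
    ...     | refl with 0<∣p∣⇒Nonempty (edge H i - w) (subst (0 <_) (sym size) (s≤s z≤n))
    ...       | u , u∈ = u , u∈ , p─q⊆p (edge H i) ⁅ w ⁆ u∈

  degree≡2-pair⇒CoverNumberAtMost : ∀ {r x y i} → Uniform (3 + r) H → Intersecting H → x ≢ y →
                                    x ∈ edge H i → y ∈ edge H i → degree H x ≡ 2 → degree H y ≡ 2 →
                                    CoverNumberAtMost H (2 + r)
  degree≡2-pair⇒CoverNumberAtMost {r} {x} {y} {i} uniform intersecting x≢y x∈i y∈i deg-x deg-y
    with 2≤degree⇒∈-other-edge (≤-reflexive (sym deg-x)) i
       | 2≤degree⇒∈-other-edge (≤-reflexive (sym deg-y)) i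
  ... | jx , jx≢i , x∈jx | jy , jy≢i , y∈jy with intersecting jx jy
  ... | z , z∈jx , z∈jy = C , covers , size
    where
    core : Subset n
    core = edge H i - x - y

    C : Subset n
    C = core ∪ ⁅ z ⁆

    core⊆C : ∀ {u} → u ∈ core → u ∈ C
    core⊆C u∈core = x∈p∪q⁺ (inj₁ u∈core)

    core-size : ∣ core ∣ ≡ 1 + r
    core-size = suc-injective (suc-injective (begin
      2 + ∣ core ∣          ≡⟨ cong suc (x∈p⇒suc∣p-x∣≡∣p∣ (x∈p∧x≢y⇒x∈p-y y∈i (x≢y ∘ sym))) ⟩
      1 + ∣ edge H i - x ∣  ≡⟨ x∈p⇒suc∣p-x∣≡∣p∣ x∈i ⟩
      ∣ edge H i ∣          ≡⟨ uniform i ⟩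
      3 + r                 ∎))
      where open ≡-Reasoning

    size : ∣ C ∣ ≤ 2 + r
    size = begin
      ∣ C ∣                 ≤⟨ ∣p∪q∣≤∣p∣+∣q∣ core ⁅ z ⁆ ⟩
      ∣ core ∣ + ∣ ⁅ z ⁆ ∣  ≡⟨ cong₂ _+_ core-size (∣⁅x⁆∣≡1 z) ⟩
      1 + r + 1             ≡⟨ +-comm (1 + r) 1 ⟩
      2 + r                 ∎
      where open ≤-Reasoning

    meets-i : ∃ λ u → u ∈ C × u ∈ edge H i
    meets-i with 0<∣p∣⇒Nonempty core (subst (0 <_) (sym core-size) (s≤s z≤n))
    ... | u , u∈core = u , core⊆C u∈core , p─q⊆p (edge H i) ⁅ x ⁆ (p─q⊆p (edge H i - x) ⁅ y ⁆ u∈core)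

    meets-edge-through : ∀ {a j k} → degree H a ≡ 2 → j ≢ i →
                         a ∈ edge H i → a ∈ edge H j → z ∈ edge H j → a ∈ edge H k →
                         ∃ λ u → u ∈ C × u ∈ edge H k
    meets-edge-through deg-a j≢i a∈i a∈j z∈j a∈k
      with degree≤2⇒k≡i∨k≡j (≤-reflexive deg-a) j≢i a∈i a∈j a∈k
    ... | inj₁ refl = meets-i
    ... | inj₂ refl = z , x∈p∪q⁺ (inj₂ (x∈⁅x⁆ z)) , z∈j

    covers : IsCover H C
    covers k with intersecting i k
    ... | w , w∈i , w∈k with w ≟ x | w ≟ y
    ... | yes refl | _        = meets-edge-through deg-x jx≢i x∈i x∈jx z∈jx w∈k
    ... | no  _    | yes refl = meets-edge-through deg-y jy≢i y∈i y∈jy z∈jy w∈k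
    ... | no  w≢x  | no  w≢y  = w , core⊆C (x∈p∧x≢y⇒x∈p-y (x∈p∧x≢y⇒x∈p-y w∈i w≢x) w≢y) , w∈k

  ¬CoverNumberAtMost⇒2≤degree : ∀ {r} → Uniform (2 + r) H → Intersecting H → NoIsolated H →
                                ¬ CoverNumberAtMost H (1 + r) → ∀ v → 2 ≤ degree H v
  ¬CoverNumberAtMost⇒2≤degree uniform intersecting noIsolated τ> v with noIsolated v
  ... | i , v∈i with 2 ≤? degree H v
  ...   | yes 2≤deg = 2≤deg
  ...   | no  2≰deg = ⊥-elim (τ> (degree≤1⇒CoverNumberAtMost uniform intersecting v∈i (≤-pred (≰⇒> 2≰deg))))

  degreeTwoIn : Fin m → Fin n → ℕ
  degreeTwoIn i v = incidence (edge H i) v * isTwo (degree H v)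

  ¬CoverNumberAtMost⇒∑degreeTwoIn≤1 : ∀ {r} → Uniform (3 + r) H → Intersecting H →
                                      ¬ CoverNumberAtMost H (2 + r) → ∀ i → sum (degreeTwoIn i) ≤ 1
  ¬CoverNumberAtMost⇒∑degreeTwoIn≤1 uniform intersecting τ> i with 2 ≤? sum (degreeTwoIn i)
  ... | no  2≰∑ = ≤-pred (≰⇒> 2≰∑)
  ... | yes 2≤∑ with 0<∑⇒∃0< (degreeTwoIn i) (≤-trans (s≤s z≤n) 2≤∑)
  ... | x , 0<x with 2≤∑⇒∃0<≢ (degreeTwoIn i) x (*-mono-≤ (incidence≤1 (edge H i) x) (isTwo≤1 (degree H x))) 2≤∑
  ... | y , y≢x , 0<y with 0<m*n⇒0<m∧0<n _ _ 0<x | 0<m*n⇒0<m∧0<n _ _ 0<y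
  ... | x∈i , x-two | y∈i , y-two =
    ⊥-elim (τ> (degree≡2-pair⇒CoverNumberAtMost uniform intersecting (y≢x ∘ sym)
      (0<incidence⇒∈ (edge H i) x x∈i) (0<incidence⇒∈ (edge H i) y y∈i)
      (0<isTwo⇒≡2 (degree H x) x-two) (0<isTwo⇒≡2 (degree H y) y-two)))

  ¬CoverNumberAtMost⇒∑degree*isTwo≤m : ∀ {r} → Uniform (3 + r) H → Intersecting H →
                                       ¬ CoverNumberAtMost H (2 + r) →
                                       ∑[ v < n ] (degree H v * isTwo (degree H v)) ≤ m
  ¬CoverNumberAtMost⇒∑degree*isTwo≤m uniform intersecting τ> = begin
    ∑[ v < n ] (degree H v * isTwo (degree H v))
      ≡⟨ ∑-degree-* (isTwo ∘ degree H) ⟩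
    ∑[ i < m ] sum (degreeTwoIn i)
      ≤⟨ ∑-mono-≤ (¬CoverNumberAtMost⇒∑degreeTwoIn≤1 uniform intersecting τ>) ⟩
    ∑[ i < m ] 1
      ≡⟨ trans (∑-const m 1) (*-identityʳ m) ⟩
    m
      ∎
    where open ≤-Reasoning

6≤2d+d*isTwo : ∀ d → 2 ≤ d → 6 ≤ 2 * d + d * isTwo d
6≤2d+d*isTwo 1                   (s≤s ())
6≤2d+d*isTwo 2                   _ = ≤-refl
6≤2d+d*isTwo (suc (suc (suc k))) _ = ≤-trans (*-monoʳ-≤ 2 (m≤m+n 3 k)) (m≤m+n _ _)

-- A linear majorant of d² on 2 ≤ d ≤ 6, tight at d = 2, 3 and 6; the weight of isTwo is what
-- makes it hold at d = 2.
d²+18≤9d+2d*isTwo : ∀ d → 2 ≤ d → d ≤ 6 → d * d + 18 ≤ 9 * d + 2 * (d * isTwo d)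
d²+18≤9d+2d*isTwo 1 (s≤s ()) _
d²+18≤9d+2d*isTwo 2 _ _ = ≤ᵇ⇒≤ 22 22 _
d²+18≤9d+2d*isTwo 3 _ _ = ≤ᵇ⇒≤ 27 27 _
d²+18≤9d+2d*isTwo 4 _ _ = ≤ᵇ⇒≤ 34 36 _
d²+18≤9d+2d*isTwo 5 _ _ = ≤ᵇ⇒≤ 43 45 _
d²+18≤9d+2d*isTwo 6 _ _ = ≤ᵇ⇒≤ 54 54 _
d²+18≤9d+2d*isTwo (suc (suc (suc (suc (suc (suc (suc _))))))) _ (s≤s (s≤s (s≤s (s≤s (s≤s (s≤s ()))))))

-- The maximum degree is at most 6, since Σ (2 d + d isTwo d) ≤ 132 while every term is at least 6.
-- Summing the majorant then gives Σ d² + 18 n ≤ 9 · 60 + 2 · 12.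
∑d²<192 : ∀ {n} → 21 ≤ n → (d : Fin n → ℕ) → (∀ v → 2 ≤ d v) → sum d ≡ 60 →
          ∑[ v < n ] (d v * isTwo (d v)) ≤ 12 → ∑[ v < n ] (d v * d v) < 192
∑d²<192 {n} 21≤n d 2≤d ∑d≡60 ∑e≤12 = ≤-<-trans (+-cancelʳ-≤ 378 _ 186 bound) (≤ᵇ⇒≤ 187 192 _)
  where
  e : Fin n → ℕ
  e v = d v * isTwo (d v)

  g : Fin n → ℕ
  g v = 2 * d v + e v

  ∑g≤132 : sum g ≤ 132
  ∑g≤132 = begin
    sum g                         ≡⟨ ∑-distrib-+ (λ v → 2 * d v) e ⟩
    ∑[ v < n ] (2 * d v) + sum e  ≡⟨ cong (_+ sum e) (*-distribˡ-sum 2 d) ⟨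
    2 * sum d + sum e             ≤⟨ +-mono-≤ (≤-reflexive (cong (2 *_) ∑d≡60)) ∑e≤12 ⟩
    132                           ∎
    where open ≤-Reasoning

  d≤6 : ∀ v → d v ≤ 6
  d≤6 v with d v ≤? 6
  ... | yes d≤6 = d≤6
  ... | no  d≰6 = ⊥-elim (<⇒≱ (≤ᵇ⇒≤ 133 134 _) (≤-trans 134≤∑g ∑g≤132))
    where
    134≤∑g : 134 ≤ sum g
    134≤∑g = begin
      14 + 20 * 6
        ≤⟨ +-mono-≤ (≤-trans (*-monoʳ-≤ 2 (≰⇒> d≰6)) (m≤m+n _ _)) (*-monoˡ-≤ 6 (pred-mono-≤ 21≤n)) ⟩
      g v + pred n * 6
        ≤⟨ fᵢ+[m-1]a≤∑f g v (λ u _ → 6≤2d+d*isTwo (d u) (2≤d u)) ⟩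
      sum g
        ∎
      where open ≤-Reasoning

  bound : ∑[ v < n ] (d v * d v) + 378 ≤ 186 + 378
  bound = begin
    ∑[ v < n ] (d v * d v) + 378
      ≤⟨ +-monoʳ-≤ (∑[ v < n ] (d v * d v)) (*-monoˡ-≤ 18 21≤n) ⟩
    ∑[ v < n ] (d v * d v) + n * 18
      ≡⟨ cong (∑[ v < n ] (d v * d v) +_) (∑-const n 18) ⟨
    ∑[ v < n ] (d v * d v) + ∑[ v < n ] 18
      ≡⟨ ∑-distrib-+ (λ v → d v * d v) (λ _ → 18) ⟨
    ∑[ v < n ] (d v * d v + 18)
      ≤⟨ ∑-mono-≤ (λ v → d²+18≤9d+2d*isTwo (d v) (2≤d v) (d≤6 v)) ⟩
    ∑[ v < n ] (9 * d v + 2 * e v)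
      ≡⟨ ∑-distrib-+ (λ v → 9 * d v) (λ v → 2 * e v) ⟩
    ∑[ v < n ] (9 * d v) + ∑[ v < n ] (2 * e v)
      ≡⟨ cong₂ _+_ (*-distribˡ-sum 9 d) (*-distribˡ-sum 2 e) ⟨
    9 * sum d + 2 * sum e
      ≤⟨ +-mono-≤ (≤-reflexive (cong (9 *_) ∑d≡60)) (*-monoʳ-≤ 2 ∑e≤12) ⟩
    186 + 378
      ∎
    where open ≤-Reasoning

CoverNumberAtMost? : ∀ {n m} (H : Hypergraph n m) k → Dec (CoverNumberAtMost H k)
CoverNumberAtMost? H k =
  anySubset? (λ C → all? (λ i → any? (λ v → (v ∈? C) ×-dec (v ∈? edge H i))) ×-dec (∣ C ∣ ≤? k))

mainTheorem5 : ∀ (n : ℕ) → 21 ≤ n → (H : Hypergraph n 12) →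
    Uniform 5 H → Intersecting H → NoIsolated H → CoverNumberAtMost H 4
mainTheorem5 n 21≤n H uniform intersecting noIsolated with CoverNumberAtMost? H 4
... | yes τ≤4 = τ≤4
... | no  τ≰4 = ⊥-elim (<⇒≱ ∑degree²<192 (m[r+m-1]≤∑degree² H uniform intersecting))
  where
  ∑degree²<192 : ∑[ v < n ] (degree H v * degree H v) < 192
  ∑degree²<192 = ∑d²<192 21≤n (degree H)
    (¬CoverNumberAtMost⇒2≤degree H uniform intersecting noIsolated τ≰4)
    (handshake H uniform)
    (¬CoverNumberAtMost⇒∑degree*isTwo≤m H uniform intersecting τ≰4)
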